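{- For all $n \ge 2$, $|\mathfrak{S}_n(1243, 2143, 231)| = (n+2)2^{n-3}$. Moreover, $$\sum_{n=0}^\infty |\mathfrak{S}_n(1243,2143,231)|\,x^n = 1 + x\frac{(x-1)^2}{(2x-1)^2}.$$
   Context: $\mathfrak{S}_n(R)$ is the set of permutations of $\{1,\dots,n\}$ that contain no subsequence with the same relative order as any pattern in $R$. -}

module Defs where

open import Data.Nat as ℕ using (ℕ)
open import Data.Integer as ℤ using (ℤ; +_)
open import Data.Fin using (Fin; zero; suc; _<_)
open import Data.Vec using (Vec; lookup; []; _∷_)
open import Data.List using (List; length; map; upTo; foldr)
open import Data.List.Relation.Unary.Unique.Propositional using (Unique)
open import Data.List.Membership.Propositional using (_∈_)
open import Data.Product using (Σ; _×_)
open import Function.Definitions using (Injective)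
open import Function.Bundles using (_⇔_)
open import Relation.Binary.PropositionalEquality using (_≡_)
open import Relation.Nullary using (¬_)

-- A permutation of {1,…,n} in one-line notation: σ(i+1) = lookup σ i + 1
-- (0-based values/positions in Fin n); the one-line vector must be injective.
IsPerm : ∀ {n} → Vec (Fin n) n → Set
IsPerm σ = Injective _≡_ _≡_ (lookup σ)

Contains : ∀ {n k} → Vec (Fin n) n → Vec (Fin k) k → Set
Contains {n} {k} σ p =
  Σ (Fin k → Fin n) λ f →
    (∀ a b → a < b → f a < f b) ×
    (∀ a b → (lookup p a < lookup p b) ⇔ (lookup σ (f a) < lookup σ (f b)))

Avoids : ∀ {n k} → Vec (Fin n) n → Vec (Fin k) k → Set
Avoids σ p = ¬ Contains σ p

p1243 : Vec (Fin 4) 4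
p1243 = zero ∷ suc zero ∷ suc (suc (suc zero)) ∷ suc (suc zero) ∷ []

p2143 : Vec (Fin 4) 4
p2143 = suc zero ∷ zero ∷ suc (suc (suc zero)) ∷ suc (suc zero) ∷ []

p231 : Vec (Fin 3) 3
p231 = suc zero ∷ suc (suc zero) ∷ zero ∷ []

InClass : ∀ {n} → Vec (Fin n) n → Set
InClass σ = IsPerm σ × Avoids σ p1243 × Avoids σ p2143 × Avoids σ p231

HasCard : ∀ {n} → (Vec (Fin n) n → Set) → ℕ → Set
HasCard {n} P c =
  Σ (List (Vec (Fin n) n)) λ L →
    Unique L × (∀ σ → (σ ∈ L) ⇔ P σ) × length L ≡ c

Series : Set
Series = ℕ → ℤ

infixl 6 _⊕_ _⊖_
infixl 7 _⊛_

_⊕_ : Series → Series → Series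
(f ⊕ g) n = f n ℤ.+ g n

_⊖_ : Series → Series → Series
(f ⊖ g) n = f n ℤ.- g n

_⊛_ : Series → Series → Series
(f ⊛ g) n = foldr ℤ._+_ (+ 0) (map (λ i → f i ℤ.* g (n ℕ.∸ i)) (upTo (ℕ.suc n)))

const : ℤ → Series
const c ℕ.zero    = c
const c (ℕ.suc _) = + 0

X : Series
X (ℕ.suc ℕ.zero) = + 1
X _          = + 0

fromℕSeq : (ℕ → ℕ) → Series
fromℕSeq a n = + (a n)

{-# OPTIONS --safe #-}
module Submission where

-- Let n be the largest entry of a 231-avoiding permutation σ = α n β; then every entry of α is
-- smaller than every entry of β.  If moreover α has at least two entries and β is nonempty, two
-- entries of α, n and an entry of β form a 1243 or a 2143.  So σ ∈ 𝔖(1243, 2143, 231) is n σ′,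
-- or σ′ n, or 1 n β, where β (shifted down by one) avoids 231 and also 132, since 1 followed by
-- a 132 is a 1243.  A permutation avoiding 132 and 231 has its maximum at one of its ends, so
-- there are 2^(m-1) of them of size m ≥ 1.  Hence a(n+1) = 2 a(n) + 2^(n-2) for n ≥ 2, which
-- gives the closed form and shows that (1 - 2x)² A(x) is a polynomial.

open import Defs
open import Data.Empty using (⊥-elim)
open import Data.Fin as Fin using (Fin; toℕ; fromℕ; inject₁; #_)
open import Data.Fin.Properties as Fin
  using (toℕ-injective; toℕ-inject₁; toℕ-fromℕ; toℕ<n; toℕ-fromℕ<; fromℕ≢inject₁;
         punchIn-punchOut; punchOut-injective; injective⇒≤; any?; all?)
open import Data.Integer as ℤ using (ℤ; +_; -[1+_])
import Data.Integer.Properties as ℤ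
import Data.Integer.Tactic.RingSolver as ℤ
open import Data.List using (List; []; _∷_; _++_; [_]; map; tabulate; length; foldr; applyUpTo)
open import Data.List.Membership.Propositional using (_∈_; _∉_)
open import Data.List.Membership.Propositional.Properties
  using (∈-map⁺; ∈-map⁻; ∈-∃++; ∈-++⁺ˡ; ∈-++⁺ʳ; ∈-++⁻; ∈-tabulate⁺)
open import Data.List.Properties
  using (length-++; length-map; ++-identityʳ; map-++; map-∘; map-cong; map-injective;
         ∷-injectiveˡ; ∷-injectiveʳ; ∷ʳ-injectiveˡ)
open import Data.List.Relation.Binary.Disjoint.Propositional using (Disjoint)
open import Data.List.Relation.Binary.Permutation.Propositional using (_↭_; ↭-sym; ↭⇒↭ₛ)
open import Data.List.Relation.Binary.Permutation.Propositional.Properties using (All-resp-↭; ∈-resp-↭; shift)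
import Data.List.Relation.Binary.Permutation.Setoid.Properties as PermutationSetoid
open import Data.List.Relation.Binary.Sublist.Propositional
  using (_⊆_; []; _∷_; _∷ʳ_; ⊆-refl; ⊆-trans; from∈)
import Data.List.Relation.Binary.Sublist.Propositional.Properties as Sublist
open import Data.List.Relation.Unary.All as All using (All; []; _∷_)
import Data.List.Relation.Unary.All.Properties as All
open import Data.List.Relation.Unary.AllPairs using (AllPairs; []; _∷_)
open import Data.List.Relation.Unary.Any using (here; there)
open import Data.List.Relation.Unary.Linked using (Linked; [-]; _∷_)
open import Data.List.Relation.Unary.Linked.Properties using (Linked⇒AllPairs)
open import Data.List.Relation.Unary.Unique.Propositional using (Unique)
import Data.List.Relation.Unary.Unique.Propositional.Properties as Unique
open import Data.Nat using (ℕ; zero; suc; _+_; _*_; _^_; _∸_; _≤_; _<_; s≤s; z<s; s<s; s<s⁻¹; s≤s⁻¹)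
open import Data.Nat.Properties
  using (+-identityʳ; <-irrefl; <-asym; <-cmp; <-trans; n<1+n; m<1+n⇒m<n∨m≡n; m<n⇒m<1+n; suc-injective;
         ≤∧≢⇒<)
open import Data.Nat.Tactic.RingSolver using (solve-∀)
open import Data.Product using (Σ; ∃; _×_; _,_; proj₁; proj₂; map₂)
open import Data.Sum as Sum using (_⊎_; inj₁; inj₂)
open import Data.Vec as Vec using (Vec; []; _∷_; lookup)
import Data.Vec.Properties as Vec
open import Function using (_∘_)
open import Function.Bundles using (_⇔_; mk⇔; Equivalence)
open import Function.Definitions using (Injective)
open import Function.Properties.Equivalence using (⇔-setoid)
open import Level using (0ℓ)
open import Relation.Binary using (tri<; tri≈; tri>)
open import Relation.Binary.PropositionalEquality
  using (_≡_; _≢_; refl; sym; trans; cong; cong₂; subst; subst₂; setoid; module ≡-Reasoning)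
open import Relation.Nullary using (¬_; yes; no)
open import Relation.Nullary.Decidable using (from-yes)

-- Permutation words

record IsPermWord (n : ℕ) (xs : List ℕ) : Set where
  field
    unique   : Unique xs
    bounded  : All (_< n) xs
    complete : ∀ {v} → v < n → v ∈ xs

open IsPermWord

[]-isPermWord : IsPermWord 0 []
[]-isPermWord = record { unique = [] ; bounded = [] ; complete = λ () }

IsPermWord-0 : ∀ {xs} → IsPermWord 0 xs → xs ≡ []
IsPermWord-0 {[]}    _ = refl
IsPermWord-0 {_ ∷ _} p with bounded p
... | () ∷ _

IsPermWord-resp-↭ : ∀ {n xs ys} → xs ↭ ys → IsPermWord n xs → IsPermWord n ys
IsPermWord-resp-↭ xs↭ys p = record
  { unique   = PermutationSetoid.Unique-resp-↭ (setoid ℕ) (↭⇒↭ₛ xs↭ys) (unique p)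
  ; bounded  = All-resp-↭ xs↭ys (bounded p)
  ; complete = ∈-resp-↭ xs↭ys ∘ complete p
  }

∷-max⁺ : ∀ {n xs} → IsPermWord n xs → IsPermWord (suc n) (n ∷ xs)
∷-max⁺ {n} {xs} p = record
  { unique   = All.map (λ x<n n≡x → <-irrefl (sym n≡x) x<n) (bounded p) ∷ unique p
  ; bounded  = n<1+n n ∷ All.map m<n⇒m<1+n (bounded p)
  ; complete = complete′
  }
  where
  complete′ : ∀ {v} → v < suc n → v ∈ n ∷ xs
  complete′ v<1+n with m<1+n⇒m<n∨m≡n v<1+n
  ... | inj₁ v<n = there (complete p v<n)
  ... | inj₂ v≡n = here v≡n

∷-max⁻ : ∀ {n xs} → IsPermWord (suc n) (n ∷ xs) → IsPermWord n xs
∷-max⁻ {n} {xs} p with unique p | bounded p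
... | n∉xs ∷ xs-unique | _ ∷ xs<1+n = record
  { unique   = xs-unique
  ; bounded  = All.zipWith (λ (n≢x , x<1+n) → ≤∧≢⇒< (s≤s⁻¹ x<1+n) (n≢x ∘ sym)) (n∉xs , xs<1+n)
  ; complete = complete′
  }
  where
  complete′ : ∀ {v} → v < n → v ∈ xs
  complete′ v<n with complete p (m<n⇒m<1+n v<n)
  ... | here v≡n   = ⊥-elim (<-irrefl v≡n v<n)
  ... | there v∈xs = v∈xs

insert-max : ∀ {n} ys zs → IsPermWord n (ys ++ zs) → IsPermWord (suc n) (ys ++ n ∷ zs)
insert-max {n} ys zs = IsPermWord-resp-↭ (↭-sym (shift n ys zs)) ∘ ∷-max⁺

remove-max : ∀ {n} ys zs → IsPermWord (suc n) (ys ++ n ∷ zs) → IsPermWord n (ys ++ zs)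
remove-max {n} ys zs = ∷-max⁻ ∘ IsPermWord-resp-↭ (shift n ys zs)

below-max : ∀ {n} ys zs {x} → IsPermWord (suc n) (ys ++ n ∷ zs) → x ∈ ys ++ zs → x < n
below-max ys zs p = All.lookup (bounded (remove-max ys zs p))

∷ʳ-max⁺ : ∀ {n xs} → IsPermWord n xs → IsPermWord (suc n) (xs ++ [ n ])
∷ʳ-max⁺ {n} {xs} = insert-max xs [] ∘ subst (IsPermWord n) (sym (++-identityʳ xs))

∷ʳ-max⁻ : ∀ {n xs} → IsPermWord (suc n) (xs ++ [ n ]) → IsPermWord n xs
∷ʳ-max⁻ {n} {xs} = subst (IsPermWord n) (++-identityʳ xs) ∘ remove-max xs []

0∷map-suc⁺ : ∀ {n ws} → IsPermWord n ws → IsPermWord (suc n) (0 ∷ map suc ws)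
0∷map-suc⁺ {n} {ws} p = record
  { unique   = All.map⁺ (All.universal (λ _ ()) ws) ∷ Unique.map⁺ suc-injective (unique p)
  ; bounded  = z<s ∷ All.map⁺ (All.map s<s (bounded p))
  ; complete = complete′
  }
  where
  complete′ : ∀ {v} → v < suc n → v ∈ 0 ∷ map suc ws
  complete′ {zero}  _     = here refl
  complete′ {suc v} v<1+n = there (∈-map⁺ suc (complete p (s<s⁻¹ v<1+n)))

0∷map-suc⁻ : ∀ {n ws} → IsPermWord (suc n) (0 ∷ map suc ws) → IsPermWord n ws
0∷map-suc⁻ {n} {ws} p with unique p | bounded p
... | _ ∷ ws-unique | _ ∷ ws<1+n = record
  { unique   = Unique.map⁻ ws-unique
  ; bounded  = All.map s<s⁻¹ (All.map⁻ ws<1+n)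
  ; complete = complete′
  }
  where
  complete′ : ∀ {v} → v < n → v ∈ ws
  complete′ v<n with complete p (s<s v<n)
  ... | there 1+v∈ with ∈-map⁻ suc 1+v∈
  ...   | _ , v∈ws , refl = v∈ws

min-max-prefix⁺ : ∀ {n ws} → IsPermWord n ws → IsPermWord (suc (suc n)) (0 ∷ suc n ∷ map suc ws)
min-max-prefix⁺ = insert-max [ 0 ] _ ∘ 0∷map-suc⁺

min-max-prefix⁻ : ∀ {n ws} → IsPermWord (suc (suc n)) (0 ∷ suc n ∷ map suc ws) → IsPermWord n ws
min-max-prefix⁻ = 0∷map-suc⁻ ∘ remove-max [ 0 ] _

-- Pattern occurrences in words

data Has231 (xs : List ℕ) : Set where
  has231 : ∀ {a b c} → a ∷ b ∷ c ∷ [] ⊆ xs → c < a → a < b → Has231 xs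

data Has132 (xs : List ℕ) : Set where
  has132 : ∀ {a b c} → a ∷ b ∷ c ∷ [] ⊆ xs → a < c → c < b → Has132 xs

-- 1243 and 2143 differ only in the order of their first two entries.
data Has1243∨2143 (xs : List ℕ) : Set where
  has1243∨2143 : ∀ {a b c d} → a ∷ b ∷ c ∷ d ∷ [] ⊆ xs → a < d → b < d → d < c → Has1243∨2143 xs

Av231-132 : List ℕ → Set
Av231-132 xs = ¬ Has231 xs × ¬ Has132 xs

Av231-1243-2143 : List ℕ → Set
Av231-1243-2143 xs = ¬ Has231 xs × ¬ Has1243∨2143 xs

Av231-132-[] : Av231-132 []
Av231-132-[] = (λ { (has231 () _ _) }) , (λ { (has132 () _ _) })

Av231-1243-2143-[] : Av231-1243-2143 []
Av231-1243-2143-[] = (λ { (has231 () _ _) }) , (λ { (has1243∨2143 () _ _ _) })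

Has231-mono : ∀ {xs ys} → xs ⊆ ys → Has231 xs → Has231 ys
Has231-mono xs⊆ys (has231 s c<a a<b) = has231 (⊆-trans s xs⊆ys) c<a a<b

Has132-mono : ∀ {xs ys} → xs ⊆ ys → Has132 xs → Has132 ys
Has132-mono xs⊆ys (has132 s a<c c<b) = has132 (⊆-trans s xs⊆ys) a<c c<b

Has1243∨2143-mono : ∀ {xs ys} → xs ⊆ ys → Has1243∨2143 xs → Has1243∨2143 ys
Has1243∨2143-mono xs⊆ys (has1243∨2143 s a<d b<d d<c) = has1243∨2143 (⊆-trans s xs⊆ys) a<d b<d d<c

Av231-132-antimono : ∀ {xs ys} → xs ⊆ ys → Av231-132 ys → Av231-132 xs
Av231-132-antimono xs⊆ys (¬231 , ¬132) = ¬231 ∘ Has231-mono xs⊆ys , ¬132 ∘ Has132-mono xs⊆ys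

Av231-1243-2143-antimono : ∀ {xs ys} → xs ⊆ ys → Av231-1243-2143 ys → Av231-1243-2143 xs
Av231-1243-2143-antimono xs⊆ys (¬231 , ¬43) = ¬231 ∘ Has231-mono xs⊆ys , ¬43 ∘ Has1243∨2143-mono xs⊆ys

∷ʳ-⊆-∷ʳ⁻ : ∀ {A : Set} {x y : A} xs ys → xs ++ [ x ] ⊆ ys ++ [ y ] →
           xs ++ [ x ] ⊆ ys ⊎ (x ≡ y × xs ⊆ ys)
∷ʳ-⊆-∷ʳ⁻ []          []       (refl ∷ []) = inj₂ (refl , [])
∷ʳ-⊆-∷ʳ⁻ (_ ∷ [])    []       (refl ∷ ())
∷ʳ-⊆-∷ʳ⁻ (_ ∷ _ ∷ _) []       (refl ∷ ())
∷ʳ-⊆-∷ʳ⁻ []          []       (_ ∷ʳ ())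
∷ʳ-⊆-∷ʳ⁻ (_ ∷ _)     []       (_ ∷ʳ ())
∷ʳ-⊆-∷ʳ⁻ []          (_ ∷ ys) (refl ∷ _) = inj₁ (refl ∷ Sublist.[]⊆-universal ys)
∷ʳ-⊆-∷ʳ⁻ (_ ∷ xs)    (_ ∷ ys) (refl ∷ s) =
  Sum.map (refl ∷_) (map₂ (refl ∷_)) (∷ʳ-⊆-∷ʳ⁻ xs ys s)
∷ʳ-⊆-∷ʳ⁻ xs          (y ∷ ys) (_ ∷ʳ s)   =
  Sum.map (y ∷ʳ_) (map₂ (y ∷ʳ_)) (∷ʳ-⊆-∷ʳ⁻ xs ys s)

Has231-∷-max : ∀ {n zs} → All (_< n) zs → Has231 (n ∷ zs) → Has231 zs
Has231-∷-max _    (has231 (_ ∷ʳ s) c<a a<b) = has231 s c<a a<b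
Has231-∷-max zs<n (has231 (refl ∷ s) _ n<b) with Sublist.All-resp-⊆ s zs<n
... | b<n ∷ _ = ⊥-elim (<-asym n<b b<n)

Has132-∷-max : ∀ {n zs} → All (_< n) zs → Has132 (n ∷ zs) → Has132 zs
Has132-∷-max _    (has132 (_ ∷ʳ s) a<c c<b) = has132 s a<c c<b
Has132-∷-max zs<n (has132 (refl ∷ s) n<c _) with Sublist.All-resp-⊆ s zs<n
... | _ ∷ c<n ∷ _ = ⊥-elim (<-asym n<c c<n)

Has1243∨2143-∷-max : ∀ {n zs} → All (_< n) zs → Has1243∨2143 (n ∷ zs) → Has1243∨2143 zs
Has1243∨2143-∷-max _    (has1243∨2143 (_ ∷ʳ s) a<d b<d d<c) = has1243∨2143 s a<d b<d d<c
Has1243∨2143-∷-max zs<n (has1243∨2143 (refl ∷ s) n<d _ _) with Sublist.All-resp-⊆ s zs<n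
... | _ ∷ _ ∷ d<n ∷ _ = ⊥-elim (<-asym n<d d<n)

Has231-∷ʳ-max : ∀ {n ys} → All (_< n) ys → Has231 (ys ++ [ n ]) → Has231 ys
Has231-∷ʳ-max {ys = ys} ys<n (has231 {a} {b} s c<a a<b) with ∷ʳ-⊆-∷ʳ⁻ (a ∷ b ∷ []) ys s
... | inj₁ s′ = has231 s′ c<a a<b
... | inj₂ (refl , s′) with Sublist.All-resp-⊆ s′ ys<n
...   | a<n ∷ _ = ⊥-elim (<-asym c<a a<n)

Has132-∷ʳ-max : ∀ {n ys} → All (_< n) ys → Has132 (ys ++ [ n ]) → Has132 ys
Has132-∷ʳ-max {ys = ys} ys<n (has132 {a} {b} s a<c c<b) with ∷ʳ-⊆-∷ʳ⁻ (a ∷ b ∷ []) ys s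
... | inj₁ s′ = has132 s′ a<c c<b
... | inj₂ (refl , s′) with Sublist.All-resp-⊆ s′ ys<n
...   | _ ∷ b<n ∷ _ = ⊥-elim (<-asym c<b b<n)

Has1243∨2143-∷ʳ-max : ∀ {n ys} → All (_< n) ys → Has1243∨2143 (ys ++ [ n ]) → Has1243∨2143 ys
Has1243∨2143-∷ʳ-max {ys = ys} ys<n (has1243∨2143 {a} {b} {c} s a<d b<d d<c)
  with ∷ʳ-⊆-∷ʳ⁻ (a ∷ b ∷ c ∷ []) ys s
... | inj₁ s′ = has1243∨2143 s′ a<d b<d d<c
... | inj₂ (refl , s′) with Sublist.All-resp-⊆ s′ ys<n
...   | _ ∷ _ ∷ c<n ∷ _ = ⊥-elim (<-asym d<c c<n)

Av231-132-∷-max : ∀ {n zs} → All (_< n) zs → Av231-132 zs → Av231-132 (n ∷ zs)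
Av231-132-∷-max zs<n (¬231 , ¬132) = ¬231 ∘ Has231-∷-max zs<n , ¬132 ∘ Has132-∷-max zs<n

Av231-132-∷ʳ-max : ∀ {n ys} → All (_< n) ys → Av231-132 ys → Av231-132 (ys ++ [ n ])
Av231-132-∷ʳ-max ys<n (¬231 , ¬132) = ¬231 ∘ Has231-∷ʳ-max ys<n , ¬132 ∘ Has132-∷ʳ-max ys<n

Av231-1243-2143-∷-max : ∀ {n zs} → All (_< n) zs → Av231-1243-2143 zs → Av231-1243-2143 (n ∷ zs)
Av231-1243-2143-∷-max zs<n (¬231 , ¬43) = ¬231 ∘ Has231-∷-max zs<n , ¬43 ∘ Has1243∨2143-∷-max zs<n

Av231-1243-2143-∷ʳ-max : ∀ {n ys} → All (_< n) ys → Av231-1243-2143 ys → Av231-1243-2143 (ys ++ [ n ])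
Av231-1243-2143-∷ʳ-max ys<n (¬231 , ¬43) = ¬231 ∘ Has231-∷ʳ-max ys<n , ¬43 ∘ Has1243∨2143-∷ʳ-max ys<n

⊆-map⁻ : ∀ {A B : Set} {f : A → B} {ys} xs → ys ⊆ map f xs → ∃ λ zs → zs ⊆ xs × ys ≡ map f zs
⊆-map⁻ []       []         = [] , [] , refl
⊆-map⁻ (x ∷ xs) (_ ∷ʳ s)   with ⊆-map⁻ xs s
... | zs , s′ , refl = zs , x ∷ʳ s′ , refl
⊆-map⁻ (x ∷ xs) (refl ∷ s) with ⊆-map⁻ xs s
... | zs , s′ , refl = x ∷ zs , refl ∷ s′ , refl

Has231-map-suc⁺ : ∀ {ws} → Has231 ws → Has231 (map suc ws)
Has231-map-suc⁺ (has231 s c<a a<b) = has231 (Sublist.map⁺ suc s) (s<s c<a) (s<s a<b)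

Has231-map-suc⁻ : ∀ {ws} → Has231 (map suc ws) → Has231 ws
Has231-map-suc⁻ {ws} (has231 s c<a a<b) with ⊆-map⁻ ws s
... | _ ∷ _ ∷ _ ∷ [] , s′ , refl = has231 s′ (s<s⁻¹ c<a) (s<s⁻¹ a<b)

Has132-map-suc⁻ : ∀ {ws} → Has132 (map suc ws) → Has132 ws
Has132-map-suc⁻ {ws} (has132 s a<c c<b) with ⊆-map⁻ ws s
... | _ ∷ _ ∷ _ ∷ [] , s′ , refl = has132 s′ (s<s⁻¹ a<c) (s<s⁻¹ c<b)

Has132⇒Has1243∨2143-after-min-max : ∀ {n ws} → Has132 ws → Has1243∨2143 (0 ∷ n ∷ map suc ws)
Has132⇒Has1243∨2143-after-min-max (has132 s a<c c<b) =
  has1243∨2143 (refl ∷ _ ∷ʳ Sublist.map⁺ suc s) z<s (s<s a<c) (s<s c<b)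

Av231-1243-2143-min-max-prefix : ∀ {n ws} → All (_< n) (map suc ws) → Av231-132 ws →
                                 Av231-1243-2143 (0 ∷ n ∷ map suc ws)
Av231-1243-2143-min-max-prefix ws<n (¬231 , ¬132) = no231 , no1243∨2143
  where
  no231 : ¬ Has231 _
  no231 (has231 (refl ∷ _) () _)
  no231 (has231 (_ ∷ʳ s) c<a a<b) = ¬231 (Has231-map-suc⁻ (Has231-∷-max ws<n (has231 s c<a a<b)))
  no1243∨2143 : ¬ Has1243∨2143 _
  no1243∨2143 (has1243∨2143 s _ b<d d<c) =
    ¬132 (Has132-map-suc⁻ (Has132-∷-max ws<n (has132 (Sublist.∷⁻ s) b<d d<c)))

-- Splitting a word at its maximum

Unique-resp-⊆ : ∀ {A : Set} {xs ys : List A} → xs ⊆ ys → Unique ys → Unique xs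
Unique-resp-⊆ []         _        = []
Unique-resp-⊆ (_ ∷ʳ s)   (_ ∷ u)  = Unique-resp-⊆ s u
Unique-resp-⊆ (refl ∷ s) (x∉ ∷ u) = Sublist.All-resp-⊆ s x∉ ∷ Unique-resp-⊆ s u

⊆-around : ∀ {A : Set} {y m z : A} {ys zs} → y ∈ ys → z ∈ zs → y ∷ m ∷ z ∷ [] ⊆ ys ++ m ∷ zs
⊆-around y∈ys z∈zs = Sublist.++⁺ (from∈ y∈ys) (refl ∷ from∈ z∈zs)

¬Has231⇒< : ∀ {xs y n z} → ¬ Has231 xs → y ∷ n ∷ z ∷ [] ⊆ xs → y < n → y ≢ z → y < z
¬Has231⇒< {y = y} {z = z} ¬231 s y<n y≢z with <-cmp y z
... | tri< y<z _ _ = y<z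
... | tri≈ _ y≡z _ = ⊥-elim (y≢z y≡z)
... | tri> _ _ z<y = ⊥-elim (¬231 (has231 s z<y y<n))

before-max<after-max : ∀ {n} ys zs {y z} → IsPermWord (suc n) (ys ++ n ∷ zs) → ¬ Has231 (ys ++ n ∷ zs) →
                       y ∈ ys → z ∈ zs → y < z
before-max<after-max ys zs {y} {z} p ¬231 y∈ys z∈zs =
  ¬Has231⇒< ¬231 (⊆-around y∈ys z∈zs) (below-max ys zs p (∈-++⁺ˡ y∈ys)) y≢z
  where
  y≢z : y ≢ z
  y≢z with Unique-resp-⊆ (⊆-around y∈ys z∈zs) (unique p)
  ... | (_ ∷ y≢z ∷ []) ∷ _ = y≢z

All≢0⇒map-suc : ∀ {xs} → All (0 ≢_) xs → ∃ λ ws → xs ≡ map suc ws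
All≢0⇒map-suc []                     = [] , refl
All≢0⇒map-suc {zero  ∷ _} (0≢0 ∷ _)  = ⊥-elim (0≢0 refl)
All≢0⇒map-suc {suc x ∷ _} (_ ∷ xs≢0) with All≢0⇒map-suc xs≢0
... | ws , refl = x ∷ ws , refl

data VShapedView (n : ℕ) : List ℕ → Set where
  max-first : ∀ {zs} → IsPermWord n zs → Av231-132 zs → VShapedView n (n ∷ zs)
  max-last  : ∀ {ys} → IsPermWord n ys → Av231-132 ys → VShapedView n (ys ++ [ n ])

vShapedView : ∀ {n xs} → IsPermWord (suc n) xs → Av231-132 xs → VShapedView n xs
vShapedView {n} p av with ∈-∃++ (complete p (n<1+n n))
... | ys , [] , refl = max-last (∷ʳ-max⁻ p) (Av231-132-antimono (Sublist.++⁺ʳ [ n ] ⊆-refl) av)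
... | [] , zs , refl = max-first (∷-max⁻ p) (Av231-132-antimono (n ∷ʳ ⊆-refl) av)
... | y ∷ ys , z ∷ zs , refl = ⊥-elim (proj₂ av (has132 (⊆-around (here refl) (here refl)) y<z z<n))
  where
  y<z : y < z
  y<z = before-max<after-max (y ∷ ys) (z ∷ zs) p (proj₁ av) (here refl) (here refl)
  z<n : z < n
  z<n = below-max (y ∷ ys) (z ∷ zs) p (∈-++⁺ʳ (y ∷ ys) (here refl))

data ClassView (n : ℕ) : List ℕ → Set where
  max-first    : ∀ {zs} → IsPermWord n zs → Av231-1243-2143 zs → ClassView n (n ∷ zs)
  max-last     : ∀ {ys} → IsPermWord n ys → Av231-1243-2143 ys → ClassView n (ys ++ [ n ])
  min-then-max : ∀ {k ws} → n ≡ suc (suc k) → IsPermWord (suc k) ws → Av231-132 ws →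
                 ClassView n (0 ∷ n ∷ map suc ws)

single-before-max≡0 : ∀ {n y z zs} → IsPermWord (suc n) (y ∷ n ∷ z ∷ zs) → ¬ Has231 (y ∷ n ∷ z ∷ zs) →
                      y ≡ 0
single-before-max≡0 {y = zero}  _ _ = refl
single-before-max≡0 {y = suc y} p ¬231 with complete p z<s
... | there (here refl) with below-max [ suc y ] _ p (here refl)
...   | ()
single-before-max≡0 {y = suc y} p ¬231 | there (there 0∈zs)
  with before-max<after-max [ suc y ] _ p ¬231 (here refl) 0∈zs
...   | ()

min-then-max-view : ∀ {n y z zs} → IsPermWord (suc n) (y ∷ n ∷ z ∷ zs) →
                    Av231-1243-2143 (y ∷ n ∷ z ∷ zs) → ClassView n (y ∷ n ∷ z ∷ zs)
min-then-max-view p (¬231 , ¬43) with single-before-max≡0 p ¬231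
... | refl with unique p
...   | (_ ∷ after≢0) ∷ _ with All≢0⇒map-suc after≢0
...     | w ∷ ws , refl with below-max [ 0 ] _ p (there (here refl))
...       | s≤s (s≤s _) = min-then-max refl (min-max-prefix⁻ p) (no231 , no132)
  where
  no231 : ¬ Has231 (w ∷ ws)
  no231 = ¬231 ∘ Has231-mono (_ ∷ʳ _ ∷ʳ ⊆-refl) ∘ Has231-map-suc⁺
  no132 : ¬ Has132 (w ∷ ws)
  no132 = ¬43 ∘ Has132⇒Has1243∨2143-after-min-max

classView : ∀ {n xs} → IsPermWord (suc n) xs → Av231-1243-2143 xs → ClassView n xs
classView {n} p av with ∈-∃++ (complete p (n<1+n n))
... | ys , [] , refl = max-last (∷ʳ-max⁻ p) (Av231-1243-2143-antimono (Sublist.++⁺ʳ [ n ] ⊆-refl) av)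
... | [] , zs , refl = max-first (∷-max⁻ p) (Av231-1243-2143-antimono (n ∷ʳ ⊆-refl) av)
... | y ∷ [] , z ∷ zs , refl = min-then-max-view p av
... | y₁ ∷ y₂ ∷ ys , z ∷ zs , refl =
  ⊥-elim (proj₂ av (has1243∨2143 y₁-y₂-n-z (before-z (here refl)) (before-z (there (here refl))) z<n))
  where
  before-z : ∀ {y} → y ∈ y₁ ∷ y₂ ∷ ys → y < z
  before-z y∈ = before-max<after-max (y₁ ∷ y₂ ∷ ys) (z ∷ zs) p (proj₁ av) y∈ (here refl)
  y₁-y₂-n-z : y₁ ∷ y₂ ∷ n ∷ z ∷ [] ⊆ y₁ ∷ y₂ ∷ ys ++ n ∷ z ∷ zs
  y₁-y₂-n-z = Sublist.++⁺ (refl ∷ refl ∷ Sublist.[]⊆-universal ys) (refl ∷ from∈ (here refl))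
  z<n : z < n
  z<n = below-max (y₁ ∷ y₂ ∷ ys) (z ∷ zs) p (∈-++⁺ʳ (y₁ ∷ y₂ ∷ ys) (here refl))

-- Enumerations

record Insertions (F : ℕ → Set) : Set where
  field
    empty         : F 0
    consMax       : ∀ n → F n → F (suc n)
    snocMax       : ∀ n → F n → F (suc n)
    prependMinMax : ∀ n → F n → F (suc (suc n))

-- Size 1 is listed on its own because consMax 0 and snocMax 0 coincide, and minThenMax 0 is
-- empty because prepending 1 2 to the empty permutation gives snocMax 1 of the singleton.
module Enumeration {F : ℕ → Set} (I : Insertions F) where
  open Insertions I

  vShaped : ∀ n → List (F n)
  vShaped zero          = [ empty ]
  vShaped (suc zero)    = [ consMax 0 empty ]
  vShaped (suc (suc n)) =
    map (snocMax (suc n)) (vShaped (suc n)) ++ map (consMax (suc n)) (vShaped (suc n))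

  minThenMax : ∀ n → List (F (suc (suc n)))
  minThenMax zero    = []
  minThenMax (suc n) = map (prependMinMax (suc n)) (vShaped (suc n))

  class : ∀ n → List (F n)
  class zero          = [ empty ]
  class (suc zero)    = [ consMax 0 empty ]
  class (suc (suc n)) =
    map (snocMax (suc n)) (class (suc n)) ++ map (consMax (suc n)) (class (suc n)) ++ minThenMax n

wordInsertions : Insertions (λ _ → List ℕ)
wordInsertions = record
  { empty         = []
  ; consMax       = λ n xs → n ∷ xs
  ; snocMax       = λ n xs → xs ++ [ n ]
  ; prependMinMax = λ n ws → 0 ∷ suc n ∷ map suc ws
  }

Perm : ℕ → Set
Perm n = Vec (Fin n) n

permInsertions : Insertions Perm
permInsertions = record
  { empty         = []
  ; consMax       = λ n σ → fromℕ n ∷ Vec.map inject₁ σ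
  ; snocMax       = λ n σ → Vec.map inject₁ σ Vec.∷ʳ fromℕ n
  ; prependMinMax = λ n σ → Fin.zero ∷ fromℕ (suc n) ∷ Vec.map (Fin.suc ∘ inject₁) σ
  }

module Words = Enumeration wordInsertions
module Perms = Enumeration permInsertions
open Insertions permInsertions

vShaped-sound : ∀ n → All (λ xs → IsPermWord n xs × Av231-132 xs) (Words.vShaped n)
vShaped-sound zero          = ([]-isPermWord , Av231-132-[]) ∷ []
vShaped-sound (suc zero)    = (∷-max⁺ []-isPermWord , Av231-132-∷-max [] Av231-132-[]) ∷ []
vShaped-sound (suc (suc n)) = All.++⁺ (All.map⁺ (All.map snoc (vShaped-sound (suc n))))
                                      (All.map⁺ (All.map cons (vShaped-sound (suc n))))
  where
  snoc : ∀ {xs} → IsPermWord (suc n) xs × Av231-132 xs →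
         IsPermWord (suc (suc n)) (xs ++ [ suc n ]) × Av231-132 (xs ++ [ suc n ])
  snoc (p , av) = ∷ʳ-max⁺ p , Av231-132-∷ʳ-max (bounded p) av
  cons : ∀ {xs} → IsPermWord (suc n) xs × Av231-132 xs →
         IsPermWord (suc (suc n)) (suc n ∷ xs) × Av231-132 (suc n ∷ xs)
  cons (p , av) = ∷-max⁺ p , Av231-132-∷-max (bounded p) av

minThenMax-sound : ∀ n → All (λ xs → IsPermWord (suc (suc n)) xs × Av231-1243-2143 xs) (Words.minThenMax n)
minThenMax-sound zero    = []
minThenMax-sound (suc n) = All.map⁺ (All.map prepend (vShaped-sound (suc n)))
  where
  prepend : ∀ {ws} → IsPermWord (suc n) ws × Av231-132 ws →
            IsPermWord (3 + n) (0 ∷ 2 + n ∷ map suc ws) × Av231-1243-2143 (0 ∷ 2 + n ∷ map suc ws)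
  prepend (p , av) = min-max-prefix⁺ p , Av231-1243-2143-min-max-prefix (All.map⁺ (All.map s<s (bounded p))) av

class-sound : ∀ n → All (λ xs → IsPermWord n xs × Av231-1243-2143 xs) (Words.class n)
class-sound zero          = ([]-isPermWord , Av231-1243-2143-[]) ∷ []
class-sound (suc zero)    = (∷-max⁺ []-isPermWord , Av231-1243-2143-∷-max [] Av231-1243-2143-[]) ∷ []
class-sound (suc (suc n)) = All.++⁺ (All.map⁺ (All.map snoc (class-sound (suc n))))
                              (All.++⁺ (All.map⁺ (All.map cons (class-sound (suc n)))) (minThenMax-sound n))
  where
  snoc : ∀ {xs} → IsPermWord (suc n) xs × Av231-1243-2143 xs →
         IsPermWord (suc (suc n)) (xs ++ [ suc n ]) × Av231-1243-2143 (xs ++ [ suc n ])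
  snoc (p , av) = ∷ʳ-max⁺ p , Av231-1243-2143-∷ʳ-max (bounded p) av
  cons : ∀ {xs} → IsPermWord (suc n) xs × Av231-1243-2143 xs →
         IsPermWord (suc (suc n)) (suc n ∷ xs) × Av231-1243-2143 (suc n ∷ xs)
  cons (p , av) = ∷-max⁺ p , Av231-1243-2143-∷-max (bounded p) av

∈-vShaped-from-view : ∀ {n xs} →
                      (∀ {ys} → IsPermWord (suc n) ys → Av231-132 ys → ys ∈ Words.vShaped (suc n)) →
                      VShapedView (suc n) xs → xs ∈ Words.vShaped (suc (suc n))
∈-vShaped-from-view complete-n (max-first p av) = ∈-++⁺ʳ _ (∈-map⁺ _ (complete-n p av))
∈-vShaped-from-view complete-n (max-last  p av) = ∈-++⁺ˡ (∈-map⁺ _ (complete-n p av))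

vShaped-complete : ∀ n {xs} → IsPermWord n xs → Av231-132 xs → xs ∈ Words.vShaped n
vShaped-complete zero p _ with IsPermWord-0 p
... | refl = here refl
vShaped-complete (suc zero) p av with vShapedView p av
... | max-first p′ _ with IsPermWord-0 p′
...   | refl = here refl
vShaped-complete (suc zero) p av | max-last p′ _ with IsPermWord-0 p′
...   | refl = here refl
vShaped-complete (suc (suc n)) p av = ∈-vShaped-from-view (vShaped-complete (suc n)) (vShapedView p av)

∈-class-from-view : ∀ {n xs} →
                    (∀ {ys} → IsPermWord (suc n) ys → Av231-1243-2143 ys → ys ∈ Words.class (suc n)) →
                    ClassView (suc n) xs → xs ∈ Words.class (suc (suc n))
∈-class-from-view complete-n (max-last p av) = ∈-++⁺ˡ (∈-map⁺ _ (complete-n p av))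
∈-class-from-view {n} complete-n (max-first p av) =
  ∈-++⁺ʳ (map (_++ [ suc n ]) (Words.class (suc n))) (∈-++⁺ˡ (∈-map⁺ _ (complete-n p av)))
∈-class-from-view {suc n} _ (min-then-max refl p av) =
  ∈-++⁺ʳ (map (_++ [ 2 + n ]) (Words.class (2 + n)))
    (∈-++⁺ʳ (map (2 + n ∷_) (Words.class (2 + n))) (∈-map⁺ _ (vShaped-complete (suc n) p av)))

class-complete : ∀ n {xs} → IsPermWord n xs → Av231-1243-2143 xs → xs ∈ Words.class n
class-complete zero p _ with IsPermWord-0 p
... | refl = here refl
class-complete (suc zero) p av with classView p av
... | max-first p′ _ with IsPermWord-0 p′
...   | refl = here refl
class-complete (suc zero) p av | max-last p′ _ with IsPermWord-0 p′
...   | refl = here refl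
class-complete (suc (suc n)) p av = ∈-class-from-view (class-complete (suc n)) (classView p av)

∈-Words-class⇔ : ∀ n xs → xs ∈ Words.class n ⇔ (IsPermWord n xs × Av231-1243-2143 xs)
∈-Words-class⇔ n xs = mk⇔ (All.lookup (class-sound n)) (λ (p , av) → class-complete n p av)

-- From permutations to words

word : ∀ {m n} → Vec (Fin m) n → List ℕ
word σ = tabulate (λ i → toℕ (lookup σ i))

word-map-inject₁ : ∀ {m n} (σ : Vec (Fin m) n) → word (Vec.map inject₁ σ) ≡ word σ
word-map-inject₁ []      = refl
word-map-inject₁ (x ∷ σ) = cong₂ _∷_ (toℕ-inject₁ x) (word-map-inject₁ σ)

word-map-suc∘inject₁ : ∀ {m n} (σ : Vec (Fin m) n) → word (Vec.map (Fin.suc ∘ inject₁) σ) ≡ map suc (word σ)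
word-map-suc∘inject₁ []      = refl
word-map-suc∘inject₁ (x ∷ σ) = cong₂ _∷_ (cong suc (toℕ-inject₁ x)) (word-map-suc∘inject₁ σ)

word-∷ʳ : ∀ {m n} (σ : Vec (Fin m) n) x → word (σ Vec.∷ʳ x) ≡ word σ ++ [ toℕ x ]
word-∷ʳ []      x = refl
word-∷ʳ (y ∷ σ) x = cong (toℕ y ∷_) (word-∷ʳ σ x)

word-consMax : ∀ n (σ : Perm n) → word (consMax n σ) ≡ n ∷ word σ
word-consMax n σ = cong₂ _∷_ (toℕ-fromℕ n) (word-map-inject₁ σ)

word-snocMax : ∀ n (σ : Perm n) → word (snocMax n σ) ≡ word σ ++ [ n ]
word-snocMax n σ =
  trans (word-∷ʳ (Vec.map inject₁ σ) (fromℕ n)) (cong₂ (λ xs x → xs ++ [ x ]) (word-map-inject₁ σ) (toℕ-fromℕ n))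

word-prependMinMax : ∀ n (σ : Perm n) → word (prependMinMax n σ) ≡ 0 ∷ suc n ∷ map suc (word σ)
word-prependMinMax n σ = cong₂ (λ x xs → 0 ∷ x ∷ xs) (cong suc (toℕ-fromℕ n)) (word-map-suc∘inject₁ σ)

map-word-natural : ∀ {m n} {f : Perm m → Perm n} {g : List ℕ → List ℕ} →
                   (∀ σ → word (f σ) ≡ g (word σ)) → ∀ {σs xss} → map word σs ≡ xss → map word (map f σs) ≡ map g xss
map-word-natural {f = f} {g} word∘f≗g∘word {σs} refl = begin
  map word (map f σs)   ≡⟨ map-∘ σs ⟨
  map (word ∘ f) σs     ≡⟨ map-cong word∘f≗g∘word σs ⟩
  map (g ∘ word) σs     ≡⟨ map-∘ σs ⟩
  map g (map word σs)   ∎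
  where open ≡-Reasoning

map-word-vShaped : ∀ n → map word (Perms.vShaped n) ≡ Words.vShaped n
map-word-vShaped zero          = refl
map-word-vShaped (suc zero)    = refl
map-word-vShaped (suc (suc n)) = trans (map-++ word (map (snocMax (suc n)) vs) _)
  (cong₂ _++_ (map-word-natural (word-snocMax (suc n)) (map-word-vShaped (suc n)))
              (map-word-natural (word-consMax (suc n)) (map-word-vShaped (suc n))))
  where
  vs : List (Perm (suc n))
  vs = Perms.vShaped (suc n)

map-word-minThenMax : ∀ n → map word (Perms.minThenMax n) ≡ Words.minThenMax n
map-word-minThenMax zero    = refl
map-word-minThenMax (suc n) = map-word-natural (word-prependMinMax (suc n)) (map-word-vShaped (suc n))

map-word-class : ∀ n → map word (Perms.class n) ≡ Words.class n
map-word-class zero          = refl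
map-word-class (suc zero)    = refl
map-word-class (suc (suc n)) = trans (map-++ word (map (snocMax (suc n)) cs) _)
  (cong₂ _++_ (map-word-natural (word-snocMax (suc n)) (map-word-class (suc n)))
              (trans (map-++ word (map (consMax (suc n)) cs) _)
                     (cong₂ _++_ (map-word-natural (word-consMax (suc n)) (map-word-class (suc n)))
                                 (map-word-minThenMax n))))
  where
  cs : List (Perm (suc n))
  cs = Perms.class (suc n)

word-injective : ∀ {m n} {σ τ : Vec (Fin m) n} → word σ ≡ word τ → σ ≡ τ
word-injective {σ = []}    {[]}    _  = refl
word-injective {σ = _ ∷ _} {_ ∷ _} eq =
  cong₂ _∷_ (toℕ-injective (∷-injectiveˡ eq)) (word-injective (∷-injectiveʳ eq))

injective-via-word : ∀ {m n} {f : Perm m → Perm n} {g : List ℕ → List ℕ} →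
                     (∀ σ → word (f σ) ≡ g (word σ)) → Injective _≡_ _≡_ g → Injective _≡_ _≡_ f
injective-via-word {f = f} word∘f≗g∘word g-injective {σ} {τ} fσ≡fτ =
  word-injective (g-injective (trans (sym (word∘f≗g∘word σ)) (trans (cong word fσ≡fτ) (word∘f≗g∘word τ))))

consMax-injective : ∀ n → Injective _≡_ _≡_ (consMax n)
consMax-injective n = injective-via-word (word-consMax n) ∷-injectiveʳ

snocMax-injective : ∀ n → Injective _≡_ _≡_ (snocMax n)
snocMax-injective n = injective-via-word (word-snocMax n) (∷ʳ-injectiveˡ _ _)

prependMinMax-injective : ∀ n → Injective _≡_ _≡_ (prependMinMax n)
prependMinMax-injective n =
  injective-via-word (word-prependMinMax n) (map-injective suc-injective ∘ ∷-injectiveʳ ∘ ∷-injectiveʳ)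

Disjoint-map : ∀ {A C : Set} {f : A → C} {xs ys} → (∀ x → f x ∉ ys) → Disjoint (map f xs) ys
Disjoint-map {xs = xs} f∉ys (fx∈ , fx∈ys) with ∈-map⁻ _ fx∈
... | x , _ , refl = f∉ys x fx∈ys

snocMax∉consMax : ∀ n {τs} σ → snocMax (suc n) σ ∉ map (consMax (suc n)) τs
snocMax∉consMax n (x ∷ _) mem with ∈-map⁻ _ mem
... | _ , _ , eq = fromℕ≢inject₁ (sym (Vec.∷-injectiveˡ eq))

snocMax∉minThenMax : ∀ n σ → snocMax (suc n) σ ∉ Perms.minThenMax n
snocMax∉minThenMax (suc n) (_ ∷ y ∷ _) mem with ∈-map⁻ _ mem
... | _ , _ , eq = fromℕ≢inject₁ (sym (Vec.∷-injectiveˡ (Vec.∷-injectiveʳ eq)))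

consMax∉minThenMax : ∀ n σ → consMax (suc n) σ ∉ Perms.minThenMax n
consMax∉minThenMax (suc n) _ mem with ∈-map⁻ _ mem
... | _ , _ , ()

vShaped-unique : ∀ n → Unique (Perms.vShaped n)
vShaped-unique zero          = [] ∷ []
vShaped-unique (suc zero)    = [] ∷ []
vShaped-unique (suc (suc n)) =
  Unique.++⁺ (Unique.map⁺ (snocMax-injective (suc n)) (vShaped-unique (suc n)))
             (Unique.map⁺ (consMax-injective (suc n)) (vShaped-unique (suc n)))
             (Disjoint-map (snocMax∉consMax n))

minThenMax-unique : ∀ n → Unique (Perms.minThenMax n)
minThenMax-unique zero    = []
minThenMax-unique (suc n) = Unique.map⁺ (prependMinMax-injective _) (vShaped-unique (suc n))

class-unique : ∀ n → Unique (Perms.class n)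
class-unique zero          = [] ∷ []
class-unique (suc zero)    = [] ∷ []
class-unique (suc (suc n)) =
  Unique.++⁺ (Unique.map⁺ (snocMax-injective (suc n)) (class-unique (suc n)))
             (Unique.++⁺ (Unique.map⁺ (consMax-injective (suc n)) (class-unique (suc n))) (minThenMax-unique n)
                         (Disjoint-map (consMax∉minThenMax n)))
             (Disjoint-map (λ σ → Sum.[ snocMax∉consMax n σ , snocMax∉minThenMax n σ ] ∘ ∈-++⁻ _))

Increasing : ∀ {k n} → (Fin k → Fin n) → Set
Increasing f = ∀ a b → a Fin.< b → f a Fin.< f b

entriesAt : ∀ {m n k} → Vec (Fin m) n → (Fin k → Fin n) → Fin k → ℕ
entriesAt σ f a = toℕ (lookup σ (f a))

private
  lowered : ∀ {k n} (f : Fin k → Fin (suc n)) → (∀ a → Fin.zero ≢ f a) → Fin k → Fin n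
  lowered f 0≢f a = Fin.punchOut (0≢f a)

  suc-lowered : ∀ {k n} (f : Fin k → Fin (suc n)) 0≢f a → Fin.suc (lowered f 0≢f a) ≡ f a
  suc-lowered f 0≢f a = punchIn-punchOut (0≢f a)

  lowered-increasing : ∀ {k n} {f : Fin k → Fin (suc n)} 0≢f → Increasing f → Increasing (lowered f 0≢f)
  lowered-increasing {f = f} 0≢f f↑ a b a<b =
    s<s⁻¹ (subst₂ Fin._<_ (sym (suc-lowered f 0≢f a)) (sym (suc-lowered f 0≢f b)) (f↑ a b a<b))

⊆-tabulate⁺ : ∀ {A : Set} {k n} {h : Fin k → A} (g : Fin n → A) (f : Fin k → Fin n) →
              Increasing f → (∀ a → h a ≡ g (f a)) → tabulate h ⊆ tabulate g
⊆-tabulate⁺ {k = zero} g f _ _ = Sublist.[]⊆-universal _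
⊆-tabulate⁺ {k = suc k} {zero} g f _ _ with f Fin.zero
... | ()
⊆-tabulate⁺ {k = suc k} {suc n} {h} g f f↑ h≗g∘f with f Fin.zero in f0≡
... | Fin.zero  = trans (h≗g∘f Fin.zero) (cong g f0≡) ∷
                  ⊆-tabulate⁺ (g ∘ Fin.suc) (lowered f′ 0≢f′) (lowered-increasing 0≢f′ f′↑) h′≗
  where
  f′ : Fin k → Fin (suc n)
  f′ a = f (Fin.suc a)
  f′↑ : Increasing f′
  f′↑ a b a<b = f↑ (Fin.suc a) (Fin.suc b) (s<s a<b)
  0≢f′ : ∀ a → Fin.zero ≢ f′ a
  0≢f′ a = Fin.<⇒≢ (subst (Fin._< f′ a) f0≡ (f↑ Fin.zero (Fin.suc a) z<s))
  h′≗ : ∀ a → h (Fin.suc a) ≡ g (Fin.suc (lowered f′ 0≢f′ a))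
  h′≗ a = trans (h≗g∘f (Fin.suc a)) (cong g (sym (suc-lowered f′ 0≢f′ a)))
... | Fin.suc _ = g Fin.zero ∷ʳ
                  ⊆-tabulate⁺ (g ∘ Fin.suc) (lowered f 0≢f) (lowered-increasing 0≢f f↑) h≗
  where
  0<f : ∀ a → Fin.zero {n} Fin.< f a
  0<f Fin.zero    = subst (Fin.zero {n} Fin.<_) (sym f0≡) z<s
  0<f (Fin.suc a) = Fin.<-trans (0<f Fin.zero) (f↑ Fin.zero (Fin.suc a) z<s)
  0≢f : ∀ a → Fin.zero ≢ f a
  0≢f a = Fin.<⇒≢ (0<f a)
  h≗ : ∀ a → h a ≡ g (Fin.suc (lowered f 0≢f a))
  h≗ a = trans (h≗g∘f a) (cong g (sym (suc-lowered f 0≢f a)))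

⊆-tabulate⁻ : ∀ {A : Set} {n} (g : Fin n → A) {ys} → ys ⊆ tabulate g →
              Σ (Fin (length ys) → Fin n) λ f → Increasing f × ys ≡ tabulate (g ∘ f)
⊆-tabulate⁻ {n = zero}  g []         = (λ ()) , (λ ()) , refl
⊆-tabulate⁻ {n = suc n} g (_ ∷ʳ s)   with ⊆-tabulate⁻ (g ∘ Fin.suc) s
... | f , f↑ , ys≡ = Fin.suc ∘ f , (λ a b a<b → s<s (f↑ a b a<b)) , ys≡
⊆-tabulate⁻ {n = suc n} g {_ ∷ ys} (refl ∷ s) with ⊆-tabulate⁻ (g ∘ Fin.suc) s
... | f , f↑ , ys≡ = f′ , f′↑ , cong (g Fin.zero ∷_) ys≡
  where
  f′ : Fin (suc (length ys)) → Fin (suc n)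
  f′ Fin.zero    = Fin.zero
  f′ (Fin.suc a) = Fin.suc (f a)
  f′↑ : Increasing f′
  f′↑ Fin.zero    (Fin.suc b) _   = z<s
  f′↑ (Fin.suc a) (Fin.suc b) a<b = s<s (f↑ a b (s<s⁻¹ a<b))

AllPairs-tabulate⁻ : ∀ {A : Set} {R : A → A → Set} {n} {h : Fin n → A} →
                     AllPairs R (tabulate h) → ∀ {i j} → i Fin.< j → R (h i) (h j)
AllPairs-tabulate⁻ (Rh0 ∷ _)  {Fin.zero}  {Fin.suc j} _   = All.lookup Rh0 (∈-tabulate⁺ j)
AllPairs-tabulate⁻ (_ ∷ Rhs) {Fin.suc i} {Fin.suc j} i<j = AllPairs-tabulate⁻ Rhs (s<s⁻¹ i<j)

-- q inverts p, so the chain says that w increases along the positions of 0, 1, …, k-1 in p.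
order-iso : ∀ {k} (p q : Vec (Fin k) k) → (∀ a → lookup q (lookup p a) ≡ a) → (w : Fin k → ℕ) →
            Linked _<_ (tabulate (w ∘ lookup q)) → ∀ a b → (lookup p a Fin.< lookup p b) ⇔ (w a < w b)
order-iso p q q∘p≗id w chain a b = mk⇔ mono reflect
  where
  mono : ∀ {a b} → lookup p a Fin.< lookup p b → w a < w b
  mono {a} {b} pa<pb =
    subst₂ _<_ (cong w (q∘p≗id a)) (cong w (q∘p≗id b))
           (AllPairs-tabulate⁻ (Linked⇒AllPairs <-trans chain) pa<pb)
  reflect : w a < w b → lookup p a Fin.< lookup p b
  reflect wa<wb with Fin.<-cmp (lookup p a) (lookup p b)
  ... | tri< pa<pb _ _ = pa<pb
  ... | tri≈ _ pa≡pb _ = ⊥-elim (<-irrefl (cong w a≡b) wa<wb)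
    where
    a≡b : a ≡ b
    a≡b = trans (sym (q∘p≗id a)) (trans (cong (lookup q) pa≡pb) (q∘p≗id b))
  ... | tri> _ _ pb<pa = ⊥-elim (<-asym wa<wb (mono pb<pa))

q231 : Vec (Fin 3) 3
q231 = # 2 ∷ # 0 ∷ # 1 ∷ []

q231∘p231≗id : ∀ a → lookup q231 (lookup p231 a) ≡ a
q231∘p231≗id = from-yes (all? λ a → lookup q231 (lookup p231 a) Fin.≟ a)

p1243-involutive : ∀ a → lookup p1243 (lookup p1243 a) ≡ a
p1243-involutive = from-yes (all? λ a → lookup p1243 (lookup p1243 a) Fin.≟ a)

p2143-involutive : ∀ a → lookup p2143 (lookup p2143 a) ≡ a
p2143-involutive = from-yes (all? λ a → lookup p2143 (lookup p2143 a) Fin.≟ a)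

Contains-231⇒Has231 : ∀ {n} (σ : Perm n) → Contains σ p231 → Has231 (word σ)
Contains-231⇒Has231 σ (f , f↑ , iso) =
  has231 (⊆-tabulate⁺ {h = entriesAt σ f} _ f f↑ (λ _ → refl))
         (Equivalence.to (iso (# 2) (# 0)) z<s) (Equivalence.to (iso (# 0) (# 1)) (s<s z<s))

Contains-1243⇒Has1243∨2143 : ∀ {n} (σ : Perm n) → Contains σ p1243 → Has1243∨2143 (word σ)
Contains-1243⇒Has1243∨2143 σ (f , f↑ , iso) =
  has1243∨2143 (⊆-tabulate⁺ {h = entriesAt σ f} _ f f↑ (λ _ → refl))
               (Equivalence.to (iso (# 0) (# 3)) z<s) (Equivalence.to (iso (# 1) (# 3)) (s<s z<s))
               (Equivalence.to (iso (# 3) (# 2)) (s<s (s<s z<s)))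

Contains-2143⇒Has1243∨2143 : ∀ {n} (σ : Perm n) → Contains σ p2143 → Has1243∨2143 (word σ)
Contains-2143⇒Has1243∨2143 σ (f , f↑ , iso) =
  has1243∨2143 (⊆-tabulate⁺ {h = entriesAt σ f} _ f f↑ (λ _ → refl))
               (Equivalence.to (iso (# 0) (# 3)) (s<s z<s)) (Equivalence.to (iso (# 1) (# 3)) z<s)
               (Equivalence.to (iso (# 3) (# 2)) (s<s (s<s z<s)))

Has231⇒Contains-231 : ∀ {n} (σ : Perm n) → Has231 (word σ) → Contains σ p231
Has231⇒Contains-231 σ (has231 s c<a a<b) with ⊆-tabulate⁻ _ s
... | f , f↑ , refl = f , f↑ , order-iso p231 q231 q231∘p231≗id (entriesAt σ f) (c<a ∷ a<b ∷ [-])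

Has1243∨2143⇒Contains : ∀ {n} (σ : Perm n) → Unique (word σ) → Has1243∨2143 (word σ) →
                        Contains σ p1243 ⊎ Contains σ p2143
Has1243∨2143⇒Contains σ u (has1243∨2143 s a<d b<d d<c) with ⊆-tabulate⁻ _ s | Unique-resp-⊆ s u
... | f , f↑ , refl | (a≢b ∷ _) ∷ _ with <-cmp (entriesAt σ f (# 0)) (entriesAt σ f (# 1))
...   | tri< a<b _ _ =
  inj₁ (f , f↑ , order-iso p1243 p1243 p1243-involutive (entriesAt σ f) (a<b ∷ b<d ∷ d<c ∷ [-]))
...   | tri≈ _ a≡b _ = ⊥-elim (a≢b a≡b)
...   | tri> _ _ b<a =
  inj₂ (f , f↑ , order-iso p2143 p2143 p2143-involutive (entriesAt σ f) (b<a ∷ a<d ∷ d<c ∷ [-]))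

Fin-injective⇒surjective : ∀ {n} {f : Fin n → Fin n} → Injective _≡_ _≡_ f → ∀ j → ∃ λ i → f i ≡ j
Fin-injective⇒surjective {suc n} {f} f-injective j with any? (λ i → f i Fin.≟ j)
... | yes hit = hit
... | no miss = ⊥-elim (<-irrefl refl (injective⇒≤ g-injective))
  where
  j≢f : ∀ i → j ≢ f i
  j≢f i j≡fi = miss (i , sym j≡fi)
  g : Fin (suc n) → Fin n
  g i = Fin.punchOut (j≢f i)
  g-injective : Injective _≡_ _≡_ g
  g-injective {i} {i′} gi≡gi′ = f-injective (punchOut-injective (j≢f i) (j≢f i′) gi≡gi′)

Unique-tabulate⁻ : ∀ {A : Set} {n} {f : Fin n → A} → Unique (tabulate f) → Injective _≡_ _≡_ f
Unique-tabulate⁻ _         {Fin.zero}  {Fin.zero}  _   = refl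
Unique-tabulate⁻ (f0∉ ∷ _) {Fin.zero}  {Fin.suc j} eq  = ⊥-elim (All.lookup f0∉ (∈-tabulate⁺ j) eq)
Unique-tabulate⁻ (f0∉ ∷ _) {Fin.suc i} {Fin.zero}  eq  = ⊥-elim (All.lookup f0∉ (∈-tabulate⁺ i) (sym eq))
Unique-tabulate⁻ (_ ∷ u)   {Fin.suc i} {Fin.suc j} eq  = cong Fin.suc (Unique-tabulate⁻ u eq)

IsPerm⇔IsPermWord : ∀ {n} (σ : Perm n) → IsPerm σ ⇔ IsPermWord n (word σ)
IsPerm⇔IsPermWord {n} σ = mk⇔ to (λ p → Unique-tabulate⁻ (unique p) ∘ cong toℕ)
  where
  to : IsPerm σ → IsPermWord n (word σ)
  to σ-injective = record
    { unique   = Unique.tabulate⁺ (σ-injective ∘ toℕ-injective)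
    ; bounded  = All.tabulate⁺ (λ i → toℕ<n (lookup σ i))
    ; complete = complete′
    }
    where
    complete′ : ∀ {v} → v < n → v ∈ word σ
    complete′ v<n with Fin-injective⇒surjective σ-injective (Fin.fromℕ< v<n)
    ... | i , σi≡v = subst (_∈ word σ) (trans (cong toℕ σi≡v) (toℕ-fromℕ< v<n)) (∈-tabulate⁺ i)

InClass⇔word : ∀ {n} (σ : Perm n) → InClass σ ⇔ (IsPermWord n (word σ) × Av231-1243-2143 (word σ))
InClass⇔word {n} σ = mk⇔ to from
  where
  to : InClass σ → IsPermWord n (word σ) × Av231-1243-2143 (word σ)
  to (σ-perm , ¬1243 , ¬2143 , ¬231) =
    p , ¬231 ∘ Has231⇒Contains-231 σ , Sum.[ ¬1243 , ¬2143 ] ∘ Has1243∨2143⇒Contains σ (unique p)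
    where
    p : IsPermWord n (word σ)
    p = Equivalence.to (IsPerm⇔IsPermWord σ) σ-perm
  from : IsPermWord n (word σ) × Av231-1243-2143 (word σ) → InClass σ
  from (p , ¬231 , ¬43) =
    Equivalence.from (IsPerm⇔IsPermWord σ) p ,
    ¬43 ∘ Contains-1243⇒Has1243∨2143 σ , ¬43 ∘ Contains-2143⇒Has1243∨2143 σ , ¬231 ∘ Contains-231⇒Has231 σ

∈-Perms-class⇔ : ∀ {n} (σ : Perm n) → σ ∈ Perms.class n ⇔ word σ ∈ Words.class n
∈-Perms-class⇔ {n} σ = mk⇔ (subst (word σ ∈_) (map-word-class n) ∘ ∈-map⁺ word) from
  where
  from : word σ ∈ Words.class n → σ ∈ Perms.class n
  from wσ∈ with ∈-map⁻ word (subst (word σ ∈_) (sym (map-word-class n)) wσ∈)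
  ... | τ , τ∈ , wσ≡wτ = subst (_∈ Perms.class n) (sym (word-injective wσ≡wτ)) τ∈

class-hasCard : ∀ n → HasCard {n} InClass (length (Perms.class n))
class-hasCard n = Perms.class n , class-unique n , ∈-class⇔InClass , refl
  where
  open import Relation.Binary.Reasoning.Setoid (⇔-setoid 0ℓ)
  ∈-class⇔InClass : ∀ σ → σ ∈ Perms.class n ⇔ InClass σ
  ∈-class⇔InClass σ = begin
    σ ∈ Perms.class n                                    ≈⟨ ∈-Perms-class⇔ σ ⟩
    word σ ∈ Words.class n                               ≈⟨ ∈-Words-class⇔ n (word σ) ⟩
    (IsPermWord n (word σ) × Av231-1243-2143 (word σ))   ≈⟨ InClass⇔word σ ⟨
    InClass σ                                            ∎

-- Counting

classSize : ℕ → ℕ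
classSize n = length (Perms.class n)

length-map-++ : ∀ {A B : Set} (f : A → B) xs {ys} → length (map f xs ++ ys) ≡ length xs + length ys
length-map-++ f xs {ys} = trans (length-++ (map f xs)) (cong (_+ length ys) (length-map f xs))

vShaped-length : ∀ n → length (Perms.vShaped (suc n)) ≡ 2 ^ n
vShaped-length zero    = refl
vShaped-length (suc n) = begin
  length (map _ vs ++ map _ vs)   ≡⟨ length-map-++ _ vs ⟩
  length vs + length (map _ vs)   ≡⟨ cong (λ m → length vs + m) (length-map _ vs) ⟩
  length vs + length vs           ≡⟨ cong (λ m → m + m) (vShaped-length n) ⟩
  2 ^ n + 2 ^ n                   ≡⟨ cong (λ m → 2 ^ n + m) (+-identityʳ (2 ^ n)) ⟨
  2 ^ suc n                       ∎
  where
  open ≡-Reasoning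
  vs : List (Perm (suc n))
  vs = Perms.vShaped (suc n)

classSize-recurrence : ∀ k → classSize (3 + k) ≡ 2 * classSize (2 + k) + 2 ^ k
classSize-recurrence k = begin
  length (map _ cs ++ map _ cs ++ map _ vs)   ≡⟨ length-map-++ _ cs ⟩
  length cs + length (map _ cs ++ map _ vs)   ≡⟨ cong (λ m → length cs + m) (length-map-++ _ cs) ⟩
  length cs + (length cs + length (map _ vs)) ≡⟨ cong (λ m → length cs + (length cs + m)) (length-map _ vs) ⟩
  length cs + (length cs + length vs)         ≡⟨ cong (λ m → length cs + (length cs + m)) (vShaped-length k) ⟩
  length cs + (length cs + 2 ^ k)             ≡⟨ double (length cs) (2 ^ k) ⟩
  2 * length cs + 2 ^ k                       ∎
  where
  open ≡-Reasoning
  double : ∀ c t → c + (c + t) ≡ 2 * c + t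
  double = solve-∀
  cs : List (Perm (2 + k))
  cs = Perms.class (2 + k)
  vs : List (Perm (suc k))
  vs = Perms.vShaped (suc k)

classSize-closed-form : ∀ n → 2 ≤ n → 8 * classSize n ≡ (n + 2) * 2 ^ n
classSize-closed-form (suc zero)    (s≤s ())
classSize-closed-form (suc (suc j)) _ = closed j
  where
  open ≡-Reasoning
  distrib : ∀ c t → 8 * (2 * c + t) ≡ 2 * (8 * c) + 8 * t
  distrib = solve-∀
  collect : ∀ j t → 2 * ((2 + j + 2) * (2 * (2 * t))) + 8 * t ≡ (3 + j + 2) * (2 * (2 * (2 * t)))
  collect = solve-∀
  closed : ∀ j → 8 * classSize (2 + j) ≡ (2 + j + 2) * 2 ^ (2 + j)
  closed zero    = refl
  closed (suc j) = begin
    8 * classSize (3 + j)                          ≡⟨ cong (8 *_) (classSize-recurrence j) ⟩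
    8 * (2 * classSize (2 + j) + 2 ^ j)            ≡⟨ distrib (classSize (2 + j)) (2 ^ j) ⟩
    2 * (8 * classSize (2 + j)) + 8 * 2 ^ j        ≡⟨ cong (λ c → 2 * c + 8 * 2 ^ j) (closed j) ⟩
    2 * ((2 + j + 2) * 2 ^ (2 + j)) + 8 * 2 ^ j    ≡⟨ collect j (2 ^ j) ⟩
    (3 + j + 2) * 2 ^ (3 + j)                      ∎

classSize-linear-recurrence : ∀ k → classSize (4 + k) + 4 * classSize (2 + k) ≡ 4 * classSize (3 + k)
classSize-linear-recurrence k rewrite classSize-recurrence (suc k) | classSize-recurrence k =
  expand (classSize (2 + k)) (2 ^ k)
  where
  expand : ∀ c t → 2 * (2 * c + t) + 2 * t + 4 * c ≡ 4 * (2 * c + t)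
  expand = solve-∀

-- The generating function

sum-vanishing : ∀ (t : ℕ → ℤ) (s : ℕ → ℕ) n → (∀ i → t (s i) ≡ + 0) →
                foldr ℤ._+_ (+ 0) (map t (applyUpTo s n)) ≡ + 0
sum-vanishing t s zero    _       = refl
sum-vanishing t s (suc n) t∘s≗0 = cong₂ ℤ._+_ (t∘s≗0 0) (sum-vanishing t (s ∘ suc) n (t∘s≗0 ∘ suc))

⊛-quadratic : ∀ f g → (∀ i → f (3 + i) ≡ + 0) → ∀ n →
              (f ⊛ g) (2 + n) ≡ f 0 ℤ.* g (2 + n) ℤ.+ f 1 ℤ.* g (1 + n) ℤ.+ f 2 ℤ.* g n
⊛-quadratic f g f-vanishes n = begin
  f 0 ℤ.* g (2 + n) ℤ.+ (f 1 ℤ.* g (1 + n) ℤ.+ (f 2 ℤ.* g n ℤ.+ tail))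
    ≡⟨ cong (λ t → f 0 ℤ.* g (2 + n) ℤ.+ (f 1 ℤ.* g (1 + n) ℤ.+ (f 2 ℤ.* g n ℤ.+ t))) tail≡0 ⟩
  f 0 ℤ.* g (2 + n) ℤ.+ (f 1 ℤ.* g (1 + n) ℤ.+ (f 2 ℤ.* g n ℤ.+ + 0))
    ≡⟨ regroup (f 0 ℤ.* g (2 + n)) (f 1 ℤ.* g (1 + n)) (f 2 ℤ.* g n) ⟩
  f 0 ℤ.* g (2 + n) ℤ.+ f 1 ℤ.* g (1 + n) ℤ.+ f 2 ℤ.* g n ∎
  where
  open ≡-Reasoning
  tail : ℤ
  tail = foldr ℤ._+_ (+ 0) (map (λ i → f i ℤ.* g ((2 + n) ∸ i)) (applyUpTo (λ i → 3 + i) n))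
  tail≡0 : tail ≡ + 0
  tail≡0 = sum-vanishing _ _ n (λ i → cong (ℤ._* g _) (f-vanishes i))
  regroup : ∀ a b c → a ℤ.+ (b ℤ.+ (c ℤ.+ + 0)) ≡ a ℤ.+ b ℤ.+ c
  regroup = ℤ.solve-∀

twoX-1 X-1 twoX-1² X-1² : Series
twoX-1  = const (+ 2) ⊛ X ⊖ const (+ 1)
X-1     = X ⊖ const (+ 1)
twoX-1² = twoX-1 ⊛ twoX-1
X-1²    = X-1 ⊛ X-1

twoX-1-vanishes : ∀ i → twoX-1 (2 + i) ≡ + 0
twoX-1-vanishes i = cong (ℤ._- + 0) (⊛-quadratic (const (+ 2)) X (λ _ → refl) i)

twoX-1²-vanishes : ∀ i → twoX-1² (3 + i) ≡ + 0
twoX-1²-vanishes i = trans (⊛-quadratic twoX-1 twoX-1 (twoX-1-vanishes ∘ suc) (1 + i))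
  (cong₂ (λ u v → twoX-1 0 ℤ.* u ℤ.+ twoX-1 1 ℤ.* v ℤ.+ twoX-1 2 ℤ.* twoX-1 (1 + i))
         (twoX-1-vanishes (1 + i)) (twoX-1-vanishes i))

X-1²-vanishes : ∀ i → X-1² (3 + i) ≡ + 0
X-1²-vanishes i = ⊛-quadratic X-1 X-1 (λ _ → refl) (1 + i)

x+4z≡4y⇒x-4y+4z≡0 : ∀ x y z → x + 4 * z ≡ 4 * y →
                    + 1 ℤ.* + x ℤ.+ -[1+ 3 ] ℤ.* + y ℤ.+ + 4 ℤ.* + z ≡ + 0
x+4z≡4y⇒x-4y+4z≡0 x y z x+4z≡4y = begin
  + 1 ℤ.* + x ℤ.+ -[1+ 3 ] ℤ.* + y ℤ.+ + 4 ℤ.* + z  ≡⟨ regroup (+ x) (+ y) (+ z) ⟩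
  (+ x ℤ.+ + 4 ℤ.* + z) ℤ.- + 4 ℤ.* + y            ≡⟨ cong₂ ℤ._-_ x+4z-cast (ℤ.pos-* 4 y) ⟨
  + (x + 4 * z) ℤ.- + (4 * y)                       ≡⟨ cong (λ t → + t ℤ.- + (4 * y)) x+4z≡4y ⟩
  + (4 * y) ℤ.- + (4 * y)                           ≡⟨ ℤ.+-inverseʳ (+ (4 * y)) ⟩
  + 0                                               ∎
  where
  open ≡-Reasoning
  regroup : ∀ a b c → + 1 ℤ.* a ℤ.+ -[1+ 3 ] ℤ.* b ℤ.+ + 4 ℤ.* c ≡ (a ℤ.+ + 4 ℤ.* c) ℤ.- + 4 ℤ.* b
  regroup = ℤ.solve-∀
  x+4z-cast : + (x + 4 * z) ≡ + x ℤ.+ + 4 ℤ.* + z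
  x+4z-cast = trans (ℤ.pos-+ x (4 * z)) (cong (λ t → + x ℤ.+ t) (ℤ.pos-* 4 z))

generating-function : ∀ m → (twoX-1² ⊛ fromℕSeq classSize) m ≡ (twoX-1² ⊕ X ⊛ X-1²) m
generating-function 0 = refl
generating-function 1 = refl
generating-function 2 = refl
generating-function 3 = refl
generating-function (suc (suc (suc (suc k)))) = begin
  (twoX-1² ⊛ A) (4 + k)
    ≡⟨ ⊛-quadratic twoX-1² A twoX-1²-vanishes (2 + k) ⟩
  + 1 ℤ.* + a (4 + k) ℤ.+ -[1+ 3 ] ℤ.* + a (3 + k) ℤ.+ + 4 ℤ.* + a (2 + k)
    ≡⟨ x+4z≡4y⇒x-4y+4z≡0 (a (4 + k)) (a (3 + k)) (a (2 + k)) (classSize-linear-recurrence k) ⟩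
  + 0
    ≡⟨ cong₂ ℤ._+_ (twoX-1²-vanishes (1 + k)) X⊛X-1²-vanishes ⟨
  (twoX-1² ⊕ X ⊛ X-1²) (4 + k) ∎
  where
  open ≡-Reasoning
  a : ℕ → ℕ
  a = classSize
  A : Series
  A = fromℕSeq classSize
  X⊛X-1²-vanishes : (X ⊛ X-1²) (4 + k) ≡ + 0
  X⊛X-1²-vanishes = trans (⊛-quadratic X X-1² (λ _ → refl) (2 + k))
                          (cong (λ r → + 0 ℤ.* X-1² (4 + k) ℤ.+ + 1 ℤ.* r ℤ.+ + 0 ℤ.* X-1² (2 + k))
                                (X-1²-vanishes k))

proposition7p1 : Σ (ℕ → ℕ) λ a →
    (∀ n → HasCard {n} InClass (a n)) ×
    (∀ n → 2 ≤ n → 8 * a n ≡ (n + 2) * 2 ^ n) ×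
    (∀ m → ((const (+ 2) ⊛ X ⊖ const (+ 1)) ⊛ (const (+ 2) ⊛ X ⊖ const (+ 1)) ⊛ fromℕSeq a) m
    ≡ ((const (+ 2) ⊛ X ⊖ const (+ 1)) ⊛ (const (+ 2) ⊛ X ⊖ const (+ 1))
    ⊕ X ⊛ ((X ⊖ const (+ 1)) ⊛ (X ⊖ const (+ 1)))) m)
proposition7p1 = classSize , class-hasCard , classSize-closed-form , generating-function
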